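{- Let $f$ be an unsatisfiable CNF formula in the Boolean variables $x_1,\dots,x_n$, and let $G$ be the graph representation of a Resolution refutation $C_1,\dots,C_s$ of $f$ (as described in the context). Then for every node $u$ of $G$ and every variable $x_i$: if the literal $x_i$ appears in the clause $u$ then $x_i \in \mathrm{Zeros}(u)$, and if the literal $\neg x_i$ appears in the clause $u$ then $x_i \in \mathrm{Ones}(u)$.
   Context: A literal is a variable $x_i$ or its negation $\neg x_i$; a clause is a disjunction of literals; a CNF formula is a conjunction of clauses. If $C, D$ are clauses, the clause $C\vee D$ is the resolvent of $C\vee x_i$ and $D\vee \neg x_i$ on the variable $x_i$. A Resolution refutation of a CNF formula $f$ is a sequence of clauses $C_1,\dots,C_s$ such that each $C_j$ is either a clause of $f$ or a resolvent of two earlier clauses of the sequence, and $C_s$ is the empty clause. It is assumed that no clause of the refutation contains both $x_i$ and $\neg x_i$ for any $i$. Graph representation: $G$ is the directed acyclic graph with vertex set $C_1,\dots,C_s$ in which each clause that is an original clause of $f$ has out-degree $0$ (these are the leaves) and every other clause $C_j$, derived as the resolvent $C\vee D$ of $C\vee x_i$ and $D\vee\neg x_i$, has two outgoing edges to these two clauses. It is assumed that the only vertex of in-degree $0$ is $C_s$, called the root. Each non-leaf vertex $u$ derived by resolving on $x_i$ is labelled $\mathrm{Label}(u)=x_i$; its edge to the clause containing $x_i$ (i.e. $C\vee x_i$) is labelled $0$, and its edge to the clause containing $\neg x_i$ (i.e. $D\vee\neg x_i$) is labelled $1$. For a directed path $p$ in $G$ starting at the root, $p$ evaluates $x_i$ to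 $0$ (resp. $1$) if some node $v$ on $p$ with $\mathrm{Label}(v)=x_i$ has an outgoing edge on $p$, and for the last such node $v$ on $p$, the edge of $p$ leaving $v$ is labelled $0$ (resp. $1$). For a node $u$ of $G$, $\mathrm{Zeros}(u)$ is the set of variables evaluated to $0$ by every path from the root to $u$, and $\mathrm{Ones}(u)$ is the set of variables evaluated to $1$ by every path from the root to $u$. -}

module Defs where

open import Data.Nat using (ℕ; suc)
open import Data.Fin using (Fin; fromℕ; _<_; _≟_)
open import Data.Bool using (Bool; true; false; not)
open import Data.List using (List; [])
open import Data.List.Membership.Propositional using (_∈_)
open import Data.List.Relation.Unary.Any using (Any)
open import Data.List.Relation.Unary.All using (All)
open import Data.Maybe using (Maybe; just; nothing)
open import Data.Product using (Σ; ∃; ∃-syntax; _×_; _,_)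
open import Data.Sum using (_⊎_)
open import Relation.Binary.PropositionalEquality using (_≡_)
open import Relation.Nullary using (¬_; yes; no)
open import Function.Bundles using (_⇔_)

-- Literals over the variables x_0 … x_{n-1} (Fin n): x_i is  pos i,  ¬x_i is  neg i.
data Lit (n : ℕ) : Set where
  pos : Fin n → Lit n
  neg : Fin n → Lit n

-- A clause is a (finite) disjunction of literals, represented by the list of its literals
-- (read as a set); a CNF formula is the list of its clauses.
Clause : ℕ → Set
Clause n = List (Lit n)

CNF : ℕ → Set
CNF n = List (Clause n)

litTrue : ∀ {n} → (Fin n → Bool) → Lit n → Set
litTrue α (pos i) = α i ≡ true
litTrue α (neg i) = α i ≡ false

Satisfies : ∀ {n} → (Fin n → Bool) → CNF n → Set
Satisfies α f = All (λ C → Any (litTrue α) C) f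

Unsatisfiable : ∀ {n} → CNF n → Set
Unsatisfiable {n} f = ¬ (Σ (Fin n → Bool) λ α → Satisfies α f)

_≈_ : ∀ {n} → Clause n → Clause n → Set
A ≈ B = ∀ l → (l ∈ A) ⇔ (l ∈ B)

IsResolvent : ∀ {n} → Clause n → Clause n → Clause n → Fin n → Set
IsResolvent {n} E A B i =
  Σ (Clause n) λ C → Σ (Clause n) λ D →
    (∀ l → (l ∈ A) ⇔ (l ≡ pos i ⊎ l ∈ C)) ×
    (∀ l → (l ∈ B) ⇔ (l ≡ neg i ⊎ l ∈ D)) ×
    (∀ l → (l ∈ E) ⇔ (l ∈ C ⊎ l ∈ D))

data Step {n m : ℕ} (f : CNF n) (cl : Fin m → Clause n) (j : Fin m) : Set where
  axiom   : cl j ∈ f → Step f cl j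
  resolve : (a b : Fin m) → a < j → b < j → (i : Fin n) →
            IsResolvent (cl j) (cl a) (cl b) i → Step f cl j

IsAxiom : ∀ {n m f cl j} → Step {n} {m} f cl j → Set
IsAxiom (axiom _) = Data.Unit.⊤ where import Data.Unit
IsAxiom (resolve _ _ _ _ _ _) = Data.Empty.⊥ where import Data.Empty

-- The edge to C ∨ x_i is labelled 0 (false), the edge to D ∨ ¬x_i is labelled 1 (true).
data Edge {n m f cl j} : Step {n} {m} f cl j → Fin m → Bool → Set where
  edge0 : ∀ {a b a<j b<j i r} → Edge (resolve a b a<j b<j i r) a false
  edge1 : ∀ {a b a<j b<j i r} → Edge (resolve a b a<j b<j i r) b true

edgeLabel : ∀ {n m f cl j} {st : Step {n} {m} f cl j} {v b} → Edge st v b → Fin n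
edgeLabel (edge0 {i = i}) = i
edgeLabel (edge1 {i = i}) = i

-- A Resolution refutation C_1 … C_s of f (here indexed by Fin s, s = suc len),
-- together with the data of its graph representation G.
record Refutation {n : ℕ} (f : CNF n) : Set where
  field
    len     : ℕ
    clause  : Fin (suc len) → Clause n
    justif  : (j : Fin (suc len)) → Step f clause j
    lastEmpty : clause (fromℕ len) ≡ []
    noTaut  : ∀ j i → ¬ (pos i ∈ clause j × neg i ∈ clause j)
    -- clauses that are original clauses of f are leaves (out-degree 0)
    origLeaf : ∀ j → clause j ∈ f → IsAxiom (justif j)
    rootOnly : ∀ v → (∀ u b → ¬ Edge (justif u) v b) → v ≡ fromℕ len

  root : Fin (suc len)
  root = fromℕ len

  data Path : Fin (suc len) → Set where
    start : Path root
    _▷_   : ∀ {u v b} → Path u → Edge (justif u) v b → Path v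

  -- The value (if any) that a path assigns to x_i: the label of the edge leaving
  -- the last node on the path labelled x_i that has an outgoing edge on the path.
  eval : ∀ {u} → Path u → Fin n → Maybe Bool
  eval start i = nothing
  eval (_▷_ {b = b} p e) i with edgeLabel e ≟ i
  ... | yes _ = just b
  ... | no  _ = eval p i

  _∈Zeros_ : Fin n → Fin (suc len) → Set
  i ∈Zeros u = (p : Path u) → eval p i ≡ just false

  _∈Ones_ : Fin n → Fin (suc len) → Set
  i ∈Ones u = (p : Path u) → eval p i ≡ just true

-- At the root, the empty clause, there is nothing to
-- prove.  A path entering v by an edge labelled b out of a node resolving on x
-- evaluates x to b, and v contains x (b = 0) or ¬x (b = 1); as v contains no
-- complementary pair, every literal on x in v has that polarity.  For the other
-- variables, every literal of v besides the resolved one is also a literal of the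
-- resolvent, so the claim is inherited from the shorter path.
module Submission where

open import Defs
open import Data.Nat using (ℕ; suc)
open import Data.Fin using (Fin; _≟_)
open import Data.Bool using (Bool; true; false)
open import Data.Maybe using (just)
open import Data.Product using (_×_; _,_)
open import Data.Sum using (_⊎_; inj₁; inj₂)
open import Data.Empty using (⊥-elim)
open import Data.List.Membership.Propositional using (_∈_)
open import Relation.Binary.PropositionalEquality using (_≡_; refl; sym; cong; subst)
open import Relation.Nullary using (¬_; yes; no)
open import Function.Bundles using (Equivalence)

-- The literal that the edge labelled b on x_i requires of its target.
lit : ∀ {n} → Bool → Fin n → Lit n
lit false i = pos i
lit true  i = neg i

lit-injectiveʳ : ∀ {n} {b c : Bool} {i j : Fin n} → lit b i ≡ lit c j → i ≡ j
lit-injectiveʳ {b = false} {false} refl = refl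
lit-injectiveʳ {b = true}  {true}  refl = refl

lit-polarity-unique : ∀ {n} {C : Clause n} {i} → ¬ (pos i ∈ C × neg i ∈ C) →
                      ∀ b c → lit b i ∈ C → lit c i ∈ C → b ≡ c
lit-polarity-unique noTaut false false _  _  = refl
lit-polarity-unique noTaut false true  x∈ ¬x∈ = ⊥-elim (noTaut (x∈ , ¬x∈))
lit-polarity-unique noTaut true  false ¬x∈ x∈ = ⊥-elim (noTaut (x∈ , ¬x∈))
lit-polarity-unique noTaut true  true  _  _  = refl

module _ {n m : ℕ} {f : CNF n} {cl : Fin m → Clause n} {w : Fin m} {st : Step f cl w} where

  edge-target-contains : ∀ {v b} (e : Edge st v b) → lit b (edgeLabel e) ∈ cl v
  edge-target-contains (edge0 {r = _ , _ , A⇔ , _ , _}) = Equivalence.from (A⇔ _) (inj₁ refl)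
  edge-target-contains (edge1 {r = _ , _ , _ , B⇔ , _}) = Equivalence.from (B⇔ _) (inj₁ refl)

  edge-target-⊆ : ∀ {v b} (e : Edge st v b) {l} → l ∈ cl v →
                  l ≡ lit b (edgeLabel e) ⊎ l ∈ cl w
  edge-target-⊆ (edge0 {r = _ , _ , A⇔ , _ , E⇔}) {l} l∈ with Equivalence.to (A⇔ l) l∈
  ... | inj₁ l≡x = inj₁ l≡x
  ... | inj₂ l∈C = inj₂ (Equivalence.from (E⇔ l) (inj₁ l∈C))
  edge-target-⊆ (edge1 {r = _ , _ , _ , B⇔ , E⇔}) {l} l∈ with Equivalence.to (B⇔ l) l∈
  ... | inj₁ l≡¬x = inj₁ l≡¬x
  ... | inj₂ l∈D = inj₂ (Equivalence.from (E⇔ l) (inj₂ l∈D))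

module _ {n : ℕ} {f : CNF n} (R : Refutation f) where
  open Refutation R

  eval-lit : ∀ {u} (p : Path u) b i → lit b i ∈ clause u → eval p i ≡ just b
  eval-lit start b i l∈ with () ← subst (lit b i ∈_) lastEmpty l∈
  eval-lit (_▷_ {b = c} p e) b i l∈ with edgeLabel e ≟ i
  ... | yes refl = cong just (lit-polarity-unique (noTaut _ i) c b (edge-target-contains e) l∈)
  ... | no x≢i with edge-target-⊆ e l∈
  ...   | inj₁ l≡ = ⊥-elim (x≢i (sym (lit-injectiveʳ l≡)))
  ...   | inj₂ l∈w = eval-lit p b i l∈w

proposition1 : ∀ {n : ℕ} (f : CNF n) → Unsatisfiable f → (R : Refutation f) →
    ∀ (u : Fin (suc (Refutation.len R))) (i : Fin n) →
      (pos i ∈ Refutation.clause R u → Refutation._∈Zeros_ R i u) ×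
      (neg i ∈ Refutation.clause R u → Refutation._∈Ones_ R i u)
proposition1 f _ R u i =
  (λ x∈u p → eval-lit R p false i x∈u) , (λ ¬x∈u p → eval-lit R p true i ¬x∈u)
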